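{- In the setting described in the context, let $n,m\in\mathbb N$ and $v\in(\mathrm{Cl}(A_n)\cup\{a\})\cup(\mathrm{Cl}(B_m)\cup\{b\})$. If $Q=q_0\dots q_w$ is an $A_n$–$B_m$–coherent trail and $P$ is an admissible $v$–$V(H)$ trail, then $Q$ and $P$ are edge-disjoint.
   Context: All graphs are finite and simple; $[n]=\{1,\dots,n\}$, $[0,n]=\{0,\dots,n\}$, $\mathbb N=\{0,1,2,\dots\}$. A trail is a walk $q_0\dots q_w$ with distinct edges; a circuit is a closed trail. For $X,Y\subseteq V$, an $X$–$Y$ trail is a trail starting in $X$, ending in $Y$, with no inner vertex in $X\cup Y$; a $v$–$Y$ trail means a $\{v\}$–$Y$ trail. Setting: $G=(V,E)$ is a 2-edge-connected graph, $k\ge1$, $e_1,\dots,e_{k+1}$ are edges of $G$, $e_{k+1}=ab$, and $H$ is a shortest circuit in $G$ containing $e_1,\dots,e_k$, labelled in traversal order so that $H=H_1e_1H_2e_2\dots e_{k-1}H_ke_k$ with segments $H_1,\dots,H_k$; each $H_j$ is a path and $<_j$ is the order in which $H$ traverses $V(H_j)$. Subtrail: a trail $P=p_0\dots p_r$ is a subtrail of $Q=q_0\dots q_w$ with witnessing interval $I_P=\{t,\dots,t+r\}\subseteq[0,w]$ if $p_h=q_{t+h}$ for all $h\in[0,r]$, or $p_h=q_{t+r-h}$ for all $h\in[0,r]$ (the empty trail is a subtrail with empty witnessing interval). For $U\subseteq V$, $j\in[k]$: $\mathrm{Ins}_j(U)=U\cap V(H_j)$; $\mathrm{Cl}_j(U)$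 is the subpath of $H_j$ from $\min_{<_j}\mathrm{Ins}_j(U)$ to $\max_{<_j}\mathrm{Ins}_j(U)$ (empty if $\mathrm{Ins}_j(U)=\emptyset$); $\mathrm{Cl}(U)=\bigcup_{j}V(\mathrm{Cl}_j(U))$. An $x$–$y$ trail $P$ (and more generally a trail $P$ from $x$ to $y$) is admissible if it lies in $G-E(H)-e_{k+1}$ and $V(P)\cap V(H)\subseteq\{x,y\}$ (trivial trails allowed). $\mathrm{Reach}(X)=\{y'\in V(H):\exists x'\in X$ with an admissible $x'$–$y'$ trail$\}$. $A_0=\emptyset$, $A_1=\mathrm{Reach}(\{a\})$, $A_{i+1}=\mathrm{Reach}(\mathrm{Cl}(A_i))$ for $i\ge1$; $B_i$ analogously with $b$. For $n,m\in\mathbb N$, a trail $Q=q_0\dots q_w$ is $A_n$–$B_m$–coherent if: (C1) $e_1,\dots,e_k\in E(Q)$, $q_0\in A_{n+1}$ and $q_w\in B_{m+1}$; (C2) for every $s\in[w]$ with $q_{s-1}q_s\in E\setminus E(H)$ there are $r,t\in[0,w]$ with $r<s\le t$, $q_r,q_t\in V(H)$, such that $q_r\dots q_t$ (the part of $Q$ between indices $r$ and $t$) is an admissible $q_r$–$q_t$ trail, and each of $A_{n+1}$ and $B_{m+1}$ contains at most one of $q_r,q_t$; (C3) for every $j\in[k]$, $\mathrm{Cl}_j(A_n)$ and $\mathrm{Cl}_j(B_m)$ are subtrails of $Q$ with witnessing intervals $I_{A_n,j}$ and $I_{B_m,j}$ such that $I_{X,j}\cap I_{Y,j'}=\emptyset$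 for all $X,Y\in\{A_n,B_m\}$ and all distinct $j\neq j'$ in $[k]$. -}

module Defs where

open import Data.Nat using (ℕ; zero; suc; _+_; _∸_; _≤_; _<_)
open import Data.Fin using (Fin)
open import Data.Product using (Σ; ∃; _×_; _,_; ∃-syntax; proj₁; proj₂)
open import Data.Sum using (_⊎_)
open import Data.Maybe using (Maybe; just; nothing)
open import Data.Empty using (⊥)
open import Relation.Nullary using (¬_)
open import Relation.Binary.PropositionalEquality using (_≡_; _≢_)

record Graph : Set₁ where
  field
    size       : ℕ
    Adj        : Fin size → Fin size → Set
    Adj-sym    : ∀ {u v} → Adj u v → Adj v u
    Adj-irrefl : ∀ {u} → ¬ Adj u u

  V : Set
  V = Fin size

-- Walks q_0 … q_len, given by the vertex function (values beyond len
-- are irrelevant).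

record Walk (V : Set) : Set where
  constructor walk
  field
    len : ℕ
    at  : ℕ → V
open Walk public

module _ {V : Set} where

  SameEdge : V → V → V → V → Set
  SameEdge u v x y = (u ≡ x × v ≡ y) ⊎ (u ≡ y × v ≡ x)

  EdgeOf : Walk V → V → V → Set
  EdgeOf W x y = ∃[ i ] (i < len W × SameEdge (at W i) (at W (suc i)) x y)

  VertexOf : Walk V → V → Set
  VertexOf W v = ∃[ i ] (i ≤ len W × at W i ≡ v)

  EdgeDistinct : Walk V → Set
  EdgeDistinct W = ∀ i j → i < j → j < len W →
    ¬ SameEdge (at W i) (at W (suc i)) (at W j) (at W (suc j))

  Closed : Walk V → Set
  Closed W = at W 0 ≡ at W (len W)

  segment : Walk V → ℕ → ℕ → Walk V
  segment W r t = walk (t ∸ r) (λ i → at W (r + i))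

  EdgeDisjoint : Walk V → Walk V → Set
  EdgeDisjoint P Q = ∀ x y → EdgeOf P x y → EdgeOf Q x y → ⊥

  IsXY : (V → Set) → (V → Set) → Walk V → Set
  IsXY X Y W = X (at W 0) × Y (at W (len W)) ×
    (∀ i → 0 < i → i < len W → ¬ X (at W i) × ¬ Y (at W i))

  -- P = p_0 … p_r is a subtrail of Q with witnessing interval
  -- {t, …, t + r}
  SubtrailAt : Walk V → Walk V → ℕ → Set
  SubtrailAt P Q t = t + len P ≤ len Q ×
    ((∀ h → h ≤ len P → at P h ≡ at Q (t + h)) ⊎
     (∀ h → h ≤ len P → at P h ≡ at Q (t + len P ∸ h)))

-- intervals of ℕ: nothing = ∅, just (t , r) = {t, …, t + r}
Interval : Set
Interval = Maybe (ℕ × ℕ)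

_∈I_ : ℕ → Interval → Set
i ∈I nothing = ⊥
i ∈I just (t , r) = t ≤ i × i ≤ t + r

DisjointI : Interval → Interval → Set
DisjointI I J = ∀ i → i ∈I I → i ∈I J → ⊥

module _ (G : Graph) where
  open Graph G

  IsWalk : Walk V → Set
  IsWalk W = ∀ i → i < len W → Adj (at W i) (at W (suc i))

  IsTrail : Walk V → Set
  IsTrail W = IsWalk W × EdgeDistinct W

  IsCircuit : Walk V → Set
  IsCircuit W = IsTrail W × Closed W

  TwoEdgeConnected : Set
  TwoEdgeConnected = 2 ≤ size ×
    (∀ u v → ∃[ W ] (IsWalk W × at W 0 ≡ u × at W (len W) ≡ v)) ×
    (∀ x y → Adj x y → ∀ u v →
       ∃[ W ] (IsWalk W × at W 0 ≡ u × at W (len W) ≡ v × ¬ EdgeOf W x y))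

-- Edges e_1 … e_k are es 0 … es (k ∸ 1), e_{k+1} = ab.
-- H = h_0 … h_L (closed, L = len H); segment H_{j+1} (0-based j < k)
-- occupies positions st j … en j of H, and e_{j+1} is the edge
-- h_{en j} h_{en j + 1}.  <_j is the order of positions.

module Setup (G : Graph) (k : ℕ) (es : ℕ → Graph.V G × Graph.V G)
             (a b : Graph.V G) (H : Walk (Graph.V G)) (st en : ℕ → ℕ) where
  open Graph G

  record IsSetting : Set where
    field
      twoEdgeConn : TwoEdgeConnected G
      k≥1         : 1 ≤ k
      es-edge     : ∀ j → j < k → Adj (proj₁ (es j)) (proj₂ (es j))
      ab-edge     : Adj a b
      H-circuit   : IsCircuit G H
      H-contains  : ∀ j → j < k → EdgeOf H (proj₁ (es j)) (proj₂ (es j))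
      H-shortest  : ∀ C → IsCircuit G C →
                    (∀ j → j < k → EdgeOf C (proj₁ (es j)) (proj₂ (es j))) →
                    len H ≤ len C
      -- H = H_1 e_1 H_2 e_2 … H_k e_k
      st-first    : st 0 ≡ 0
      st-next     : ∀ j → suc j < k → st (suc j) ≡ suc (en j)
      en-last     : suc (en (k ∸ 1)) ≡ len H
      st≤en       : ∀ j → j < k → st j ≤ en j
      e-position  : ∀ j → j < k →
                    SameEdge (at H (en j)) (at H (suc (en j)))
                             (proj₁ (es j)) (proj₂ (es j))
      H-path      : ∀ j → j < k → ∀ p p' → st j ≤ p → p ≤ en j →
                    st j ≤ p' → p' ≤ en j → at H p ≡ at H p' → p ≡ p'

  VH : V → Set
  VH = VertexOf H

  EH : V → V → Set
  EH = EdgeOf H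

  AdmissibleFrom : V → V → Walk V → Set
  AdmissibleFrom x y P = IsTrail G P ×
    (∀ i → i < len P → ¬ EH (at P i) (at P (suc i)) ×
                       ¬ SameEdge (at P i) (at P (suc i)) a b) ×
    (∀ i → i ≤ len P → VH (at P i) → at P i ≡ x ⊎ at P i ≡ y)

  AdmissibleXY : V → V → Walk V → Set
  AdmissibleXY x y P = IsXY (_≡ x) (_≡ y) P × AdmissibleFrom x y P

  Reach : (V → Set) → V → Set
  Reach X y = VH y × ∃[ x ] (X x × ∃[ P ] AdmissibleXY x y P)

  -- Ins_j(U) = ∅  (j 0-based)
  InsEmpty : ℕ → (V → Set) → Set
  InsEmpty j U = ∀ p → st j ≤ p → p ≤ en j → ¬ U (at H p)

  -- Cl_j(U) is the subpath of H at positions lo … hi: lo / hi are the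
  -- <_j-minimal / maximal positions of H_j carrying a vertex of U
  IsClj : ℕ → (V → Set) → ℕ → ℕ → Set
  IsClj j U lo hi = st j ≤ lo × lo ≤ hi × hi ≤ en j ×
    U (at H lo) × U (at H hi) ×
    (∀ p → st j ≤ p → p ≤ en j → U (at H p) → lo ≤ p × p ≤ hi)

  InCl : (V → Set) → V → Set
  InCl U v = ∃[ j ] (j < k × ∃[ lo ] ∃[ hi ] (IsClj j U lo hi ×
               ∃[ p ] (lo ≤ p × p ≤ hi × at H p ≡ v)))

  Seq : V → ℕ → V → Set
  Seq c zero = λ _ → ⊥
  Seq c (suc zero) = Reach (_≡ c)
  Seq c (suc (suc i)) = Reach (InCl (Seq c (suc i)))

  A : ℕ → V → Set
  A = Seq a

  B : ℕ → V → Set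
  B = Seq b

  ClSubtrail : ℕ → (V → Set) → Walk V → Interval → Set
  ClSubtrail j U Q I = (InsEmpty j U × I ≡ nothing) ⊎
    (∃[ lo ] ∃[ hi ] (IsClj j U lo hi × ∃[ t ] (I ≡ just (t , hi ∸ lo) ×
        SubtrailAt (segment H lo hi) Q t)))

  Coherent : ℕ → ℕ → Walk V → Set
  Coherent n m Q =
    ((∀ j → j < k → EdgeOf Q (proj₁ (es j)) (proj₂ (es j))) ×
     A (suc n) (at Q 0) × B (suc m) (at Q (len Q))) ×
    -- (C2)  (edge q_s q_{s+1}, i.e. index s+1 of the paper)
    (∀ s → s < len Q → ¬ EH (at Q s) (at Q (suc s)) →
       ∃[ r ] ∃[ t ] (r ≤ s × suc s ≤ t × t ≤ len Q ×
         VH (at Q r) × VH (at Q t) ×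
         AdmissibleXY (at Q r) (at Q t) (segment Q r t) ×
         ¬ (A (suc n) (at Q r) × A (suc n) (at Q t)) ×
         ¬ (B (suc m) (at Q r) × B (suc m) (at Q t)))) ×
    (Σ (ℕ → Interval) λ IA → Σ (ℕ → Interval) λ IB →
      ((∀ j → j < k → ClSubtrail j (A n) Q (IA j) × ClSubtrail j (B m) Q (IB j)) ×
       (∀ j j' → j < k → j' < k → j ≢ j' →
          DisjointI (IA j) (IA j') × DisjointI (IA j) (IB j') ×
          DisjointI (IB j) (IA j') × DisjointI (IB j) (IB j'))))

  AdmissibleToH : V → Walk V → Set
  AdmissibleToH v P = IsXY (_≡ v) VH P × AdmissibleFrom v (at P (len P)) P

module Submission where

-- Suppose the edge q_s q_{s+1} of Q is also the edge p_i p_{i+1} of P.  It is not in E(H),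
-- since P avoids E(H), so (C2) supplies an admissible segment q_r … q_t of Q around it whose
-- ends are neither both in A_{n+1} nor both in B_{m+1}.  Following P up to the shared edge
-- and then the segment backwards to q_r, or forwards to q_t, gives walks from v avoiding
-- E(H) ∪ {ab} and meeting V(H) only at their ends; shortcutting them gives admissible
-- trails v–q_r and v–q_t (the detour).  So both ends lie in A_{n+1} (v ∈ Cl(A_n) ∪ {a}) or
-- both in B_{m+1}, contradicting (C2).  For v = a this uses A_1 ⊆ A_{n+1}, proved inside a
-- proof of ⊥ under double negation, as Cl_j(U) needs extreme positions of U on H_j.

open import Defs
open import Data.Nat using (ℕ)
open import Data.Product using (_×_)
open import Data.Sum using (_⊎_)
open import Relation.Binary.PropositionalEquality using (_≡_)

open import Data.Nat using (zero; suc; _+_; _∸_; _≤_; _<_; z≤n; s≤s; s≤s⁻¹; _≤?_; _≤‴_; ≤‴-refl; ≤‴-step)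
open import Data.Nat.Properties
open import Data.Nat.Induction using (<-rec)
open import Data.Fin.Properties using () renaming (_≟_ to _≟ᶠ_)
open import Data.Product using (∃; ∃-syntax; _,_; proj₁; proj₂)
open import Data.Sum using (inj₁; inj₂)
open import Data.Empty using (⊥; ⊥-elim)
open import Relation.Nullary using (¬_; yes; no)
open import Relation.Nullary.Negation using (DoubleNegation)
open import Relation.Nullary.Decidable using (¬¬-excluded-middle)
open import Relation.Binary.Definitions using (DecidableEquality)
open import Relation.Binary.PropositionalEquality using (refl; sym; trans; cong; subst; subst₂; _≢_)

module _ {V : Set} where

  same-edge-sym : ∀ {u w x y : V} → SameEdge u w x y → SameEdge x y u w
  same-edge-sym (inj₁ (refl , refl)) = inj₁ (refl , refl)
  same-edge-sym (inj₂ (refl , refl)) = inj₂ (refl , refl)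

  same-edge-trans : ∀ {u w x y x' y' : V} →
                    SameEdge u w x y → SameEdge x y x' y' → SameEdge u w x' y'
  same-edge-trans (inj₁ (refl , refl)) e = e
  same-edge-trans (inj₂ (refl , refl)) (inj₁ (refl , refl)) = inj₂ (refl , refl)
  same-edge-trans (inj₂ (refl , refl)) (inj₂ (refl , refl)) = inj₁ (refl , refl)

  same-edge-flip : ∀ {u w : V} → SameEdge w u u w
  same-edge-flip = inj₂ (refl , refl)

  first-end : ∀ {u w x y : V} → SameEdge u w x y → x ≡ u ⊎ x ≡ w
  first-end (inj₁ (refl , refl)) = inj₁ refl
  first-end (inj₂ (refl , refl)) = inj₂ refl

  second-end : ∀ {u w x y : V} → SameEdge u w x y → y ≡ u ⊎ y ≡ w
  second-end (inj₁ (refl , refl)) = inj₂ refl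
  second-end (inj₂ (refl , refl)) = inj₁ refl

  edge-of-cong : ∀ {W : Walk V} {u w x y : V} → SameEdge u w x y → EdgeOf W u w → EdgeOf W x y
  edge-of-cong e (i , i< , onW) = i , i< , same-edge-trans onW e

  segment-edge : ∀ (W : Walk V) {r s} t {x y} → r ≤ s →
                 SameEdge x y (at W s) (at W (suc s)) →
                 SameEdge x y (at (segment W r t) (s ∸ r)) (at (segment W r t) (suc (s ∸ r)))
  segment-edge W {r} {s} _ r≤s =
    subst₂ (SameEdge _ _) (sym (cong (at W) (m+[n∸m]≡n r≤s)))
      (sym (cong (at W) (trans (+-suc r (s ∸ r)) (cong suc (m+[n∸m]≡n r≤s)))))

least-witness : (P : ℕ → Set) → ∀ p → P p →
                DoubleNegation (∃[ l ] (l ≤ p × P l × (∀ q → q < l → ¬ P q)))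
least-witness P = <-rec Goal lower
  where
  Goal : ℕ → Set
  Goal p = P p → DoubleNegation (∃[ l ] (l ≤ p × P l × (∀ q → q < l → ¬ P q)))
  lower : ∀ p → (∀ {q} → q < p → Goal q) → Goal p
  lower p smaller Pp done = ¬¬-excluded-middle {A = ∃[ q ] (q < p × P q)} λ where
    (yes (q , q<p , Pq)) → smaller q<p Pq λ (l , l≤q , Pl , least) →
      done (l , ≤-trans l≤q (<⇒≤ q<p) , Pl , least)
    (no none) → done (p , ≤-refl , Pp , λ q q<p Pq → none (q , q<p , Pq))

greatest-witness : (P : ℕ → Set) → ∀ N p → p ≤ N → P p →
                   DoubleNegation (∃[ h ] (p ≤ h × h ≤ N × P h × (∀ q → h < q → q ≤ N → ¬ P q)))
greatest-witness P zero p p≤0 Pp done = done (p , ≤-refl , p≤0 , Pp , λ q p<q q≤0 _ → <⇒≱ p<q (≤-trans q≤0 z≤n))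
greatest-witness P (suc N) p p≤N Pp done = ¬¬-excluded-middle {A = P (suc N)} λ where
    (yes PN) → done (suc N , p≤N , ≤-refl , PN , λ q N<q q≤N _ → <⇒≱ N<q q≤N)
    (no ¬PN) → greatest-witness P N p (p≤N' ¬PN) Pp λ (h , p≤h , h≤N , Ph , greatest) →
      done (h , p≤h , m≤n⇒m≤1+n h≤N , Ph , λ q h<q q≤N → above ¬PN greatest q h<q q≤N)
  where
  p≤N' : ¬ P (suc N) → p ≤ N
  p≤N' ¬PN = s≤s⁻¹ (≤∧≢⇒< p≤N (λ { refl → ¬PN Pp }))
  above : ∀ {h} → ¬ P (suc N) → (∀ q → h < q → q ≤ N → ¬ P q) →
          ∀ q → h < q → q ≤ suc N → ¬ P q
  above ¬PN greatest q h<q q≤N with m≤n⇒m<n∨m≡n q≤N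
  ... | inj₁ q<N = greatest q h<q (s≤s⁻¹ q<N)
  ... | inj₂ refl = ¬PN

-- Routes and paths over E-edges through vertices satisfying a predicate Ok.  A route is a
-- walk assembled from pieces; shortcutting a route at repeated vertices yields a path.
module Routes {V : Set} (_≟_ : DecidableEquality V)
              (E : V → V → Set) (E-sym : ∀ {x y} → E x y → E y x) where

  data Route (Ok : V → Set) : V → V → Set where
    stop : ∀ {x} → Ok x → Route Ok x x
    step : ∀ {x y z} → Ok x → E x y → Route Ok y z → Route Ok x z

  module _ {Ok : V → Set} where

    start-ok : ∀ {x y} → Route Ok x y → Ok x
    start-ok (stop ok) = ok
    start-ok (step ok _ _) = ok

    _++_ : ∀ {x y z} → Route Ok x y → Route Ok y z → Route Ok x z
    stop _ ++ σ = σ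
    step ok e ρ ++ σ = step ok e (ρ ++ σ)

    reverse : ∀ {x y} → Route Ok x y → Route Ok y x
    reverse (stop ok) = stop ok
    reverse (step ok e ρ) = reverse ρ ++ step (start-ok ρ) (E-sym e) (stop ok)

    along : (f : ℕ → V) {lo hi : ℕ} → lo ≤‴ hi →
            (∀ j → lo ≤ j → j < hi → E (f j) (f (suc j))) →
            (∀ j → lo ≤ j → j ≤ hi → Ok (f j)) → Route Ok (f lo) (f hi)
    along f ≤‴-refl _ ok = stop (ok _ ≤-refl ≤-refl)
    along f {lo} {hi} (≤‴-step lo<hi) e ok =
      step (ok lo ≤-refl (<⇒≤ lo<hi')) (e lo ≤-refl lo<hi')
           (along f lo<hi (λ j l j< → e j (<⇒≤ l) j<) (λ j l j≤ → ok j (<⇒≤ l) j≤))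
      where
      lo<hi' : lo < hi
      lo<hi' = ≤‴⇒≤ lo<hi

  record Path (Ok : V → Set) (x y : V) : Set where
    field
      walkOf    : Walk V
      starts    : at walkOf 0 ≡ x
      ends      : at walkOf (len walkOf) ≡ y
      injective : ∀ i j → i ≤ len walkOf → j ≤ len walkOf → at walkOf i ≡ at walkOf j → i ≡ j
      edges     : ∀ i → i < len walkOf → E (at walkOf i) (at walkOf (suc i))
      vertices  : ∀ i → i ≤ len walkOf → Ok (at walkOf i)
  open Path public

  module _ {Ok : V → Set} where

    trivial : ∀ {x} → Ok x → Path Ok x x
    trivial {x} ok = record
      { walkOf = walk 0 (λ _ → x) ; starts = refl ; ends = refl
      ; injective = λ { _ _ z≤n z≤n _ → refl } ; edges = λ _ () ; vertices = λ _ _ → ok }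

    suffix : ∀ {y z} (π : Path Ok y z) i → i ≤ len (walkOf π) → Path Ok (at (walkOf π) i) z
    suffix π i i≤ = record
      { walkOf = walk (len W ∸ i) (λ h → at W (h + i))
      ; starts = refl
      ; ends = trans (cong (at W) (m∸n+n≡m i≤)) (ends π)
      ; injective = λ h h' h≤ h'≤ e → +-cancelʳ-≡ i h h' (injective π _ _ (shifted h≤) (shifted h'≤) e)
      ; edges = λ h h< → edges π (h + i) (shifted h<)
      ; vertices = λ h h≤ → vertices π (h + i) (shifted h≤) }
      where
      W : Walk V
      W = walkOf π
      shifted : ∀ {h} → h ≤ len W ∸ i → h + i ≤ len W
      shifted h≤ = subst (_ ≤_) (m∸n+n≡m i≤) (+-monoˡ-≤ i h≤)

    cons : V → (ℕ → V) → ℕ → V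
    cons x f zero = x
    cons x f (suc h) = f h

    prepend : ∀ {x y z} → Ok x → E x y → (π : Path Ok y z) →
              (∀ i → i ≤ len (walkOf π) → at (walkOf π) i ≢ x) → Path Ok x z
    prepend {x} ok e π fresh = record
      { walkOf = walk (suc (len W)) (cons x (at W))
      ; starts = refl
      ; ends = ends π
      ; injective = distinct
      ; edges = λ { zero _ → subst (E x) (sym (starts π)) e ; (suc i) i< → edges π i (s≤s⁻¹ i<) }
      ; vertices = λ { zero _ → ok ; (suc i) i≤ → vertices π i (s≤s⁻¹ i≤) } }
      where
      W : Walk V
      W = walkOf π
      distinct : ∀ i j → i ≤ suc (len W) → j ≤ suc (len W) →
                 cons x (at W) i ≡ cons x (at W) j → i ≡ j
      distinct zero zero _ _ _ = refl
      distinct zero (suc j) _ j≤ e = ⊥-elim (fresh j (s≤s⁻¹ j≤) (sym e))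
      distinct (suc i) zero i≤ _ e = ⊥-elim (fresh i (s≤s⁻¹ i≤) e)
      distinct (suc i) (suc j) i≤ j≤ e = cong suc (injective π i j (s≤s⁻¹ i≤) (s≤s⁻¹ j≤) e)

    occurrence : (x : V) (f : ℕ → V) (n : ℕ) → (∃[ i ] (i ≤ n × f i ≡ x)) ⊎ (∀ i → i ≤ n → f i ≢ x)
    occurrence x f n with f 0 ≟ x
    ... | yes e = inj₁ (0 , z≤n , e)
    occurrence x f zero | no ne = inj₂ λ { zero _ → ne }
    occurrence x f (suc n) | no ne with occurrence x (λ i → f (suc i)) n
    ... | inj₁ (i , i≤n , e) = inj₁ (suc i , s≤s i≤n , e)
    ... | inj₂ none = inj₂ λ { zero _ → ne ; (suc i) i≤ → none i (s≤s⁻¹ i≤) }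

    -- every route contains a path between its ends: shortcut the rest of the route; if the
    -- first vertex recurs on that path, keep the path from the recurrence on, else prepend it
    shortcut : ∀ {x z} → Route Ok x z → Path Ok x z
    shortcut (stop ok) = trivial ok
    shortcut {x} {z} (step {y = y} ok e ρ) = attach (shortcut ρ)
      where
      attach : Path Ok y z → Path Ok x z
      attach π with occurrence x (at (walkOf π)) (len (walkOf π))
      ... | inj₁ (i , i≤ , recurs) = subst (λ w → Path Ok w z) recurs (suffix π i i≤)
      ... | inj₂ fresh = prepend ok e π fresh

module Argument (G : Graph) (k : ℕ) (es : ℕ → Graph.V G × Graph.V G)
                (a b : Graph.V G) (H : Walk (Graph.V G)) (st en : ℕ → ℕ)
                (setting : Setup.IsSetting G k es a b H st en) where
  open Graph G
  open Setup G k es a b H st en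
  open IsSetting setting

  Free : V → V → Set
  Free u w = Adj u w × ¬ EH u w × ¬ SameEdge u w a b

  free-sym : ∀ {u w} → Free u w → Free w u
  free-sym (adj , off-H , not-ab) =
    Adj-sym adj , (λ h → off-H (edge-of-cong same-edge-flip h)) ,
    (λ e → not-ab (same-edge-trans same-edge-flip e))

  Between : V → V → V → Set
  Between x y z = VH z → z ≡ x ⊎ z ≡ y

  open Routes _≟ᶠ_ Free free-sym

  free-step : ∀ {x y W i} → AdmissibleFrom x y W → i < len W → Free (at W i) (at W (suc i))
  free-step ((walks , _) , avoids , _) i< = walks _ i< , avoids _ i<

  admissible-path : ∀ {x y} → Path (Between x y) x y → ∃ (AdmissibleXY x y)
  admissible-path {x} {y} π =
    W , (starts π , ends π , inner) ,
    ((λ i i< → proj₁ (edges π i i<)) , edge-distinct) , (λ i i< → proj₂ (edges π i i<)) ,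
    vertices π
    where
    W : Walk V
    W = walkOf π
    inner : ∀ i → 0 < i → i < len W → ¬ at W i ≡ x × ¬ at W i ≡ y
    inner i 0<i i< =
      (λ e → <⇒≢ 0<i (sym (injective π i 0 (<⇒≤ i<) z≤n (trans e (sym (starts π)))))) ,
      (λ e → <⇒≢ i< (injective π i (len W) (<⇒≤ i<) ≤-refl (trans e (sym (ends π)))))
    edge-distinct : EdgeDistinct W
    edge-distinct i j i<j j< (inj₁ (e , _)) =
      <⇒≢ i<j (injective π i j (<⇒≤ (<-trans i<j j<)) (<⇒≤ j<) e)
    edge-distinct i j i<j j< (inj₂ (e , _)) =
      <⇒≢ (m<n⇒m<1+n i<j) (injective π i (suc j) (<⇒≤ (<-trans i<j j<)) j< e)

  inner-off-H : ∀ {x y S i} → AdmissibleXY x y S → 0 < i → i < len S → ¬ VH (at S i)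
  inner-off-H ((_ , _ , inner) , (_ , _ , on-H)) 0<i i< vh with on-H _ (<⇒≤ i<) vh
  ... | inj₁ e = proj₁ (inner _ 0<i i<) e
  ... | inj₂ e = proj₂ (inner _ 0<i i<) e

  before-end : ∀ {x y S i} → AdmissibleXY x y S → i < len S → VH (at S i) → at S i ≡ x
  before-end {i = zero} ((starts , _) , _) _ _ = starts
  before-end {i = suc i} adm i< vh = ⊥-elim (inner-off-H adm (s≤s z≤n) i< vh)

  after-start : ∀ {x y S i} → AdmissibleXY x y S → 0 < i → i ≤ len S → VH (at S i) → at S i ≡ y
  after-start adm 0<i i≤ vh with m≤n⇒m<n∨m≡n i≤
  ... | inj₁ i< = ⊥-elim (inner-off-H adm 0<i i< vh)
  ... | inj₂ refl = proj₁ (proj₂ (proj₁ adm))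

  toH-before-end : ∀ {v P i} → AdmissibleToH v P → i < len P → VH (at P i) → at P i ≡ v
  toH-before-end {i = zero} ((starts , _) , _) _ _ = starts
  toH-before-end {i = suc i} ((_ , _ , inner) , _) i< vh = ⊥-elim (proj₂ (inner (suc i) (s≤s z≤n) i<) vh)

  toH-off-H : ∀ {v P i u w} → AdmissibleToH v P → i < len P →
              SameEdge (at P i) (at P (suc i)) u w → ¬ EH u w
  toH-off-H (_ , adm) i< onP onH = proj₁ (proj₂ (free-step adm i<)) (edge-of-cong (same-edge-sym onP) onH)

  toH-prefix : ∀ {v t P i} → AdmissibleToH v P → i < len P → Route (Between v t) v (at P i)
  toH-prefix {v} {t} {P} {i} toH i< = subst (λ w → Route (Between v t) w (at P i)) (proj₁ (proj₁ toH))
    (along (at P) (≤⇒≤‴ z≤n) (λ j _ j< → free-step (proj₂ toH) (<-trans j< i<))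
           (λ j _ j≤ vh → inj₁ (toH-before-end toH (≤-<-trans j≤ i<) vh)))

  approach : ∀ {v t u P i} → AdmissibleToH v P → i < len P →
             u ≡ at P i ⊎ u ≡ at P (suc i) → Between v t u → Route (Between v t) v u
  approach toH i< (inj₁ refl) _ = toH-prefix toH i<
  approach toH i< (inj₂ refl) ok =
    toH-prefix toH i< ++ step (λ vh → inj₁ (toH-before-end toH i< vh)) (free-step (proj₂ toH) i<) (stop ok)

  -- Detour: if an admissible v–V(H) trail P and an admissible x–y trail S share an edge,
  -- then v reaches both x and y by admissible trails: follow P up to the shared edge, then
  -- S backwards to x or forwards to y, and shortcut the resulting route
  detour : ∀ {v x y P S i s} → AdmissibleToH v P → AdmissibleXY x y S → i < len P → s < len S →
           SameEdge (at P i) (at P (suc i)) (at S s) (at S (suc s)) →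
           ∃ (AdmissibleXY v x) × ∃ (AdmissibleXY v y)
  detour {v} {x} {y} {P} {S} {i} {s} toH adm i< s< shared =
    admissible-path (shortcut to-x) , admissible-path (shortcut to-y)
    where
    backwards : Route (Between v x) (at S s) x
    backwards = subst (Route (Between v x) (at S s)) (proj₁ (proj₁ adm))
      (reverse (along (at S) (≤⇒≤‴ z≤n) (λ j _ j< → free-step (proj₂ adm) (<-trans j< s<))
                      (λ j _ j≤ vh → inj₂ (before-end adm (≤-<-trans j≤ s<) vh))))
    to-x : Route (Between v x) v x
    to-x = approach toH i< (first-end shared) (λ vh → inj₂ (before-end adm s< vh)) ++ backwards
    forwards : Route (Between v y) (at S (suc s)) y
    forwards = subst (Route (Between v y) (at S (suc s))) (proj₁ (proj₂ (proj₁ adm)))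
      (along (at S) (≤⇒≤‴ s<) (λ j _ j< → free-step (proj₂ adm) j<)
             (λ j s<j j≤ vh → inj₂ (after-start adm (<-≤-trans (s≤s z≤n) s<j) j≤ vh)))
    to-y : Route (Between v y) v y
    to-y = approach toH i< (second-end shared) (λ vh → inj₂ (after-start adm (s≤s z≤n) s< vh)) ++ forwards

  on-segment : ∀ p → p < len H → ∃[ j ] (j < k × st j ≤ p × p ≤ en j)
  on-segment p p< = up-to (k ∸ 1) last<k (s≤s⁻¹ (subst (p <_) (sym en-last) p<))
    where
    last<k : k ∸ 1 < k
    last<k = subst (suc (k ∸ 1) ≤_) (m+[n∸m]≡n k≥1) ≤-refl
    up-to : ∀ j → j < k → p ≤ en j → ∃[ j' ] (j' < k × st j' ≤ p × p ≤ en j')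
    up-to zero 0<k p≤ = 0 , 0<k , subst (_≤ p) (sym st-first) z≤n , p≤
    up-to (suc j) j<k p≤ with p ≤? en j
    ... | yes p≤en = up-to j (<-trans (n<1+n j) j<k) p≤en
    ... | no p≰en = suc j , j<k , subst (_≤ p) (sym (st-next j j<k)) (≰⇒> p≰en) , p≤

  -- every vertex of H sits at a position of some segment H_j (the closing position
  -- len H carries the same vertex as position 0)
  vertex-on-segment : ∀ {z} → VH z → ∃[ j ] (j < k × ∃[ p ] (st j ≤ p × p ≤ en j × at H p ≡ z))
  vertex-on-segment (p , p≤ , Hp≡z) with m≤n⇒m<n∨m≡n p≤
  ... | inj₁ p< = let j , j<k , st≤p , p≤en = on-segment p p< in j , j<k , p , st≤p , p≤en , Hp≡z
  ... | inj₂ refl =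
    let j , j<k , st≤0 , 0≤en = on-segment 0 (subst (0 <_) en-last (s≤s z≤n))
    in j , j<k , 0 , st≤0 , 0≤en , trans (proj₂ H-circuit) Hp≡z

  -- classically, a vertex of U on H lies in Cl(U): it lies on some H_j, and the least and
  -- the greatest positions of U on H_j delimit Cl_j(U)
  in-closure : ∀ (U : V → Set) {z} → U z → VH z → DoubleNegation (InCl U z)
  in-closure U {z} Uz vh done with vertex-on-segment vh
  ... | j , j<k , p , st≤p , p≤en , Hp≡z =
    least-witness OnHj p here λ (lo , lo≤p , (st≤lo , _ , Ulo) , below) →
    greatest-witness OnHj (en j) p p≤en here λ (hi , p≤hi , hi≤en , (_ , _ , Uhi) , above) →
    done (j , j<k , lo , hi ,
          (st≤lo , ≤-trans lo≤p p≤hi , hi≤en , Ulo , Uhi ,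
           λ q st≤q q≤en Uq → ≮⇒≥ (λ q<lo → below q q<lo (st≤q , q≤en , Uq)) ,
                              ≮⇒≥ (λ hi<q → above q hi<q q≤en (st≤q , q≤en , Uq))) ,
          p , lo≤p , p≤hi , Hp≡z)
    where
    OnHj : ℕ → Set
    OnHj q = st j ≤ q × q ≤ en j × U (at H q)
    here : OnHj p
    here = st≤p , p≤en , subst U (sym Hp≡z) Uz

  stay : ∀ z → AdmissibleXY z z (walk 0 (λ _ → z))
  stay z = (refl , refl , λ _ _ ()) , ((λ _ ()) , λ _ _ _ ()) , (λ _ ()) , λ _ _ _ → inj₁ refl

  seq-on-H : ∀ c i {z} → Seq c (suc i) z → VH z
  seq-on-H c zero = proj₁
  seq-on-H c (suc i) = proj₁

  -- classically the sequence grows: a member lies in the closure of its set and reaches itself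
  seq-grows : ∀ c i {z} → Seq c (suc i) z → DoubleNegation (Seq c (suc (suc i)) z)
  seq-grows c i {z} member done = in-closure (Seq c (suc i)) member (seq-on-H c i member)
    λ cl → done (seq-on-H c i member , z , cl , _ , stay z)

  seq-from-first : ∀ c n {z} → Seq c 1 z → DoubleNegation (Seq c (suc n) z)
  seq-from-first c zero member done = done member
  seq-from-first c (suc n) member done = seq-from-first c n member λ m → seq-grows c n m done

  -- a vertex of H reached by an admissible trail from Cl(Seq c n) ∪ {c} is in Seq c (n + 1);
  -- for n = 0 the closure Cl(∅) is empty
  reached : ∀ c n {v q} → InCl (Seq c n) v ⊎ v ≡ c → VH q → ∃ (AdmissibleXY v q) →
            DoubleNegation (Seq c (suc n) q)
  reached c zero (inj₁ (_ , _ , _ , _ , (_ , _ , _ , in-empty , _) , _)) _ _ _ = in-empty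
  reached c (suc n) {v} (inj₁ cl) vh trail done = done (vh , v , cl , trail)
  reached c n (inj₂ refl) vh trail = seq-from-first c n (vh , c , refl , trail)

  SeparatingSegment : ℕ → ℕ → Walk V → ℕ → Set
  SeparatingSegment n m Q s = ∃[ r ] ∃[ t ] (r ≤ s × suc s ≤ t × t ≤ len Q ×
    VH (at Q r) × VH (at Q t) × AdmissibleXY (at Q r) (at Q t) (segment Q r t) ×
    ¬ (A (suc n) (at Q r) × A (suc n) (at Q t)) × ¬ (B (suc m) (at Q r) × B (suc m) (at Q t)))

  -- an admissible trail to V(H) from v ∈ Cl(A_n) ∪ {a} ∪ Cl(B_m) ∪ {b} shares no edge with a
  -- separating segment: by the detour both ends of the segment would be reached from v
  no-shared-edge : ∀ n m {v P Q i s} → (InCl (A n) v ⊎ v ≡ a) ⊎ (InCl (B m) v ⊎ v ≡ b) →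
                   AdmissibleToH v P → i < len P → SeparatingSegment n m Q s →
                   SameEdge (at P i) (at P (suc i)) (at Q s) (at Q (suc s)) → ⊥
  no-shared-edge n m {v} {Q = Q} source toH i<
                 (r , t , r≤s , s<t , _ , onH-r , onH-t , adm , not-both-A , not-both-B) shared
    with detour toH adm i< (∸-monoˡ-< s<t r≤s) (segment-edge Q t r≤s shared)
  ... | to-r , to-t = separated source
    where
    separated : (InCl (A n) v ⊎ v ≡ a) ⊎ (InCl (B m) v ⊎ v ≡ b) → ⊥
    separated (inj₁ from-a) =
      reached a n from-a onH-r to-r λ r∈A → reached a n from-a onH-t to-t λ t∈A → not-both-A (r∈A , t∈A)
    separated (inj₂ from-b) =
      reached b m from-b onH-r to-r λ r∈B → reached b m from-b onH-t to-t λ t∈B → not-both-B (r∈B , t∈B)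

lemma4p11 : (G : Graph) (k : ℕ) (es : ℕ → Graph.V G × Graph.V G)
            (a b : Graph.V G) (H : Walk (Graph.V G)) (st en : ℕ → ℕ) →
            Setup.IsSetting G k es a b H st en →
            (n m : ℕ) (v : Graph.V G) →
            ((Setup.InCl G k es a b H st en (Setup.A G k es a b H st en n) v ⊎ v ≡ a) ⊎
             (Setup.InCl G k es a b H st en (Setup.B G k es a b H st en m) v ⊎ v ≡ b)) →
            (Q : Walk (Graph.V G)) → IsTrail G Q →
            Setup.Coherent G k es a b H st en n m Q →
            (P : Walk (Graph.V G)) → Setup.AdmissibleToH G k es a b H st en v P →
            EdgeDisjoint Q P
lemma4p11 G k es a b H st en setting n m v source Q _ (_ , separating , _) P toH x y (s , s< , onQ) (i , i< , onP) =
  no-shared-edge n m source toH i< (separating s s< (toH-off-H toH i< shared)) shared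
  where
  open Argument G k es a b H st en setting
  shared : SameEdge (at P i) (at P (suc i)) (at Q s) (at Q (suc s))
  shared = same-edge-trans onP (same-edge-sym onQ)
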